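{- Let $(\mathsf{C}, \mathcal{A})$ be a tribe with path objects and $p\colon Y\to X$ an arrow in $\mathcal{A}$. Let $q\colon E\to Y$, $e\colon Z\to E$ and $u\colon Z\to \mathrm{Path}(p)$ be arrows with $q e=\partial^0_p u$. If $q\in\mathcal{A}$, there exists an arrow $u_!e\colon Z\to E$ such that (i) $q(u_!e)=\partial^1_p u$, and (ii) $(u_!e)f=ef$ for every commutative square $u f=\mathrm{r}_p g$ with $f\colon W\to Z$ and $g\colon W\to Y$.
   Context: An arrow $f$ has the left lifting property with respect to $g$ if every commutative square with $f$ on the left and $g$ on the right admits a diagonal filler. A tribe is a pair $(\mathsf{C},\mathcal{A})$ where $\mathsf{C}$ has a terminal object and: (a) for every pair of arrows with common codomain, at least one in $\mathcal{A}$, there is a chosen pullback; (b) $\mathcal{A}$ is closed under composition and base change; (c) all isomorphisms and terminal arrows are in $\mathcal{A}$. It has path objects if for every $p\colon Y\to X$ in $\mathcal{A}$ there is a chosen factorization of the diagonal $\langle\mathrm{id}_Y,\mathrm{id}_Y\rangle\colon Y\to Y\times_pY$ as $\mathrm{r}_p\colon Y\to\mathrm{Path}(p)$ followed by $\partial_p=\langle\partial^0_p,\partial^1_p\rangle\colon\mathrm{Path}(p)\to Y\times_pY$, such that $\partial_p\in\mathcal{A}$ and every base change of $\mathrm{r}_p$ along an arrow of $\mathcal{A}$ has the left lifting property with respect to every arrow of $\mathcal{A}$. -}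

module Defs where

open import Level using (Level; _⊔_; suc)
open import Data.Product using (Σ; _×_; _,_)
open import Relation.Binary.PropositionalEquality using (_≡_)

record Category (o ℓ : Level) : Set (suc (o ⊔ ℓ)) where
  infixr 9 _∘_
  field
    Obj   : Set o
    Hom   : Obj → Obj → Set ℓ
    id    : ∀ {A} → Hom A A
    _∘_   : ∀ {A B C} → Hom B C → Hom A B → Hom A C
    assoc : ∀ {A B C D} (h : Hom C D) (g : Hom B C) (f : Hom A B) →
            (h ∘ g) ∘ f ≡ h ∘ (g ∘ f)
    identityˡ : ∀ {A B} (f : Hom A B) → id ∘ f ≡ f
    identityʳ : ∀ {A B} (f : Hom A B) → f ∘ id ≡ f

module _ {o ℓ : Level} (C : Category o ℓ) where
  open Category C

  record IsIso {A B : Obj} (f : Hom A B) : Set ℓ where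
    field
      inv   : Hom B A
      isoˡ  : inv ∘ f ≡ id
      isoʳ  : f ∘ inv ≡ id

  record Terminal : Set (o ⊔ ℓ) where
    field
      ⊤      : Obj
      !      : ∀ A → Hom A ⊤
      !-unique : ∀ {A} (h : Hom A ⊤) → h ≡ ! A

  record Pullback {A B C' : Obj} (f : Hom A C') (g : Hom B C') : Set (o ⊔ ℓ) where
    field
      P        : Obj
      π₁       : Hom P A
      π₂       : Hom P B
      commute  : f ∘ π₁ ≡ g ∘ π₂
      ⟨_,_⟩[_] : ∀ {W} (h : Hom W A) (k : Hom W B) → f ∘ h ≡ g ∘ k → Hom W P
      π₁∘⟨⟩    : ∀ {W} (h : Hom W A) (k : Hom W B) (eq : f ∘ h ≡ g ∘ k) →
                 π₁ ∘ ⟨ h , k ⟩[ eq ] ≡ h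
      π₂∘⟨⟩    : ∀ {W} (h : Hom W A) (k : Hom W B) (eq : f ∘ h ≡ g ∘ k) →
                 π₂ ∘ ⟨ h , k ⟩[ eq ] ≡ k
      unique   : ∀ {W} (m m' : Hom W P) → π₁ ∘ m ≡ π₁ ∘ m' → π₂ ∘ m ≡ π₂ ∘ m' → m ≡ m'

  LLP : ∀ {A B C' D} → Hom A B → Hom C' D → Set ℓ
  LLP {A} {B} {C'} {D} i j =
    ∀ (t : Hom A C') (b : Hom B D) → j ∘ t ≡ b ∘ i →
    Σ (Hom B C') λ d → (d ∘ i ≡ t) × (j ∘ d ≡ b)

record TribeWithPaths (o ℓ a : Level) : Set (suc (o ⊔ ℓ ⊔ a)) where
  field
    cat      : Category o ℓ
  open Category cat public
  field
    terminal : Terminal cat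
    𝒜        : ∀ {A B} → Hom A B → Set a
  open Terminal terminal public
  field
    pbˡ : ∀ {A B C'} (f : Hom A C') (g : Hom B C') → 𝒜 f → Pullback cat f g
    pbʳ : ∀ {A B C'} (f : Hom A C') (g : Hom B C') → 𝒜 g → Pullback cat f g
    𝒜-∘       : ∀ {A B C'} {g : Hom B C'} {f : Hom A B} → 𝒜 g → 𝒜 f → 𝒜 (g ∘ f)
    𝒜-basechange : ∀ {A B C'} {f : Hom A C'} {g : Hom B C'} → 𝒜 f →
                   (pb : Pullback cat f g) → 𝒜 (Pullback.π₂ pb)
    𝒜-iso : ∀ {A B} (f : Hom A B) → IsIso cat f → 𝒜 f
    𝒜-!   : ∀ A → 𝒜 (! A)
    Path : ∀ {X Y} (p : Hom Y X) → 𝒜 p → Obj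
    r    : ∀ {X Y} (p : Hom Y X) (pA : 𝒜 p) → Hom Y (Path p pA)
    ∂    : ∀ {X Y} (p : Hom Y X) (pA : 𝒜 p) →
           Hom (Path p pA) (Pullback.P (pbˡ p p pA))
    ∂-factor : ∀ {X Y} (p : Hom Y X) (pA : 𝒜 p) →
           ∂ p pA ∘ r p pA ≡ Pullback.⟨_,_⟩[_] (pbˡ p p pA) id id _≡_.refl
    ∂-𝒜 : ∀ {X Y} (p : Hom Y X) (pA : 𝒜 p) → 𝒜 (∂ p pA)
    r-llp : ∀ {X Y} (p : Hom Y X) (pA : 𝒜 p) {T} (h : Hom T (Path p pA)) → 𝒜 h →
            (pb : Pullback cat h (r p pA)) →
            ∀ {C' D} (j : Hom C' D) → 𝒜 j → LLP cat (Pullback.π₁ pb) j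

  ∂⁰ : ∀ {X Y} (p : Hom Y X) (pA : 𝒜 p) → Hom (Path p pA) Y
  ∂⁰ p pA = Pullback.π₁ (pbˡ p p pA) ∘ ∂ p pA

  ∂¹ : ∀ {X Y} (p : Hom Y X) (pA : 𝒜 p) → Hom (Path p pA) Y
  ∂¹ p pA = Pullback.π₂ (pbˡ p p pA) ∘ ∂ p pA

module Submission where

-- Call  d : Z → E  a transport of  e : Z → E  along  u : Z → Path(p)  (over
-- q : E → Y) when  q ∘ d = ∂¹ ∘ u  and  d agrees with e wherever u factors
-- through the reflexivity map  r : Y → Path(p).
--
-- 1. The two endpoints of a reflexivity path coincide: ∂⁰ ∘ r = ∂¹ ∘ r = id.
-- 2. If the path family  h : T → Path(p)  itself lies in 𝒜, a transport of any
--    t with  q ∘ t = ∂⁰ ∘ h  is a diagonal filler of the square formed by q and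
--    the base change of r along h; it exists since that base change has the
--    left lifting property against q ∈ 𝒜.
-- 3. Transports are stable under precomposition.
-- 4. For arbitrary u, apply 2 to the universal case: the pullback T of q along
--    ∂⁰ with its projection  T → Path(p), which is in 𝒜 by base change; then
--    precompose the resulting transport with  ⟨ e , u ⟩ : Z → T.

open import Defs
open import Level using (Level; _⊔_)
open import Data.Product using (Σ; _×_; _,_; proj₁; proj₂)
open import Relation.Binary.PropositionalEquality
  using (_≡_; refl; sym; trans; cong; subst₂; module ≡-Reasoning)

module CategoryFacts {o ℓ : Level} (C : Category o ℓ) where
  open Category C
  open ≡-Reasoning

  extendʳ : ∀ {A B B' D V} {a : Hom B D} {b : Hom A B} {c : Hom B' D} {d : Hom A B'}
            (k : Hom V A) → a ∘ b ≡ c ∘ d → a ∘ (b ∘ k) ≡ c ∘ (d ∘ k)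
  extendʳ {a = a} {b} {c} {d} k sq = begin
    a ∘ (b ∘ k) ≡⟨ sym (assoc a b k) ⟩
    (a ∘ b) ∘ k ≡⟨ cong (_∘ k) sq ⟩
    (c ∘ d) ∘ k ≡⟨ assoc c d k ⟩
    c ∘ (d ∘ k) ∎

  agree-through : ∀ {A B D V} {d t : Hom B D} {i : Hom A B} {k : Hom V B}
                  (w : Hom V A) → d ∘ i ≡ t ∘ i → i ∘ w ≡ k → d ∘ k ≡ t ∘ k
  agree-through {d = d} {t} {i} {k} w di≡ti iw≡k = begin
    d ∘ k       ≡⟨ cong (d ∘_) (sym iw≡k) ⟩
    d ∘ (i ∘ w) ≡⟨ extendʳ w di≡ti ⟩
    t ∘ (i ∘ w) ≡⟨ cong (t ∘_) iw≡k ⟩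
    t ∘ k       ∎

module Transport {o ℓ a : Level} (𝕋 : TribeWithPaths o ℓ a) where
  open TribeWithPaths 𝕋
  open CategoryFacts cat
  open ≡-Reasoning

  module _ {X Y : Obj} (p : Hom Y X) (pA : 𝒜 p) where
    private module Y×ₚY = Pullback (pbˡ p p pA)

    -- Both endpoints of the reflexivity path are the identity, since
    -- ∂ ∘ r is the diagonal  Y → Y ×ₚ Y.
    ∂⁰∘r≡id : ∂⁰ p pA ∘ r p pA ≡ id
    ∂⁰∘r≡id = begin
      (Y×ₚY.π₁ ∘ ∂ p pA) ∘ r p pA   ≡⟨ assoc _ _ _ ⟩
      Y×ₚY.π₁ ∘ (∂ p pA ∘ r p pA)   ≡⟨ cong (Y×ₚY.π₁ ∘_) (∂-factor p pA) ⟩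
      Y×ₚY.π₁ ∘ Y×ₚY.⟨ id , id ⟩[ refl ] ≡⟨ Y×ₚY.π₁∘⟨⟩ id id refl ⟩
      id                            ∎

    ∂¹∘r≡id : ∂¹ p pA ∘ r p pA ≡ id
    ∂¹∘r≡id = begin
      (Y×ₚY.π₂ ∘ ∂ p pA) ∘ r p pA   ≡⟨ assoc _ _ _ ⟩
      Y×ₚY.π₂ ∘ (∂ p pA ∘ r p pA)   ≡⟨ cong (Y×ₚY.π₂ ∘_) (∂-factor p pA) ⟩
      Y×ₚY.π₂ ∘ Y×ₚY.⟨ id , id ⟩[ refl ] ≡⟨ Y×ₚY.π₂∘⟨⟩ id id refl ⟩
      id                            ∎

    ∂⁰∘r≡∂¹∘r : ∂⁰ p pA ∘ r p pA ≡ ∂¹ p pA ∘ r p pA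
    ∂⁰∘r≡∂¹∘r = trans ∂⁰∘r≡id (sym ∂¹∘r≡id)

    IsTransport : ∀ {E Z} (q : Hom E Y) (e : Hom Z E) (u : Hom Z (Path p pA))
                  (d : Hom Z E) → Set (o ⊔ ℓ)
    IsTransport {Z = Z} q e u d =
      (q ∘ d ≡ ∂¹ p pA ∘ u) ×
      (∀ {W} (f : Hom W Z) (g : Hom W Y) → u ∘ f ≡ r p pA ∘ g → d ∘ f ≡ e ∘ f)

    transport-∘ : ∀ {E Z Z'} {q : Hom E Y} {e : Hom Z E} {u : Hom Z (Path p pA)}
                  {d : Hom Z E} (s : Hom Z' Z) →
                  IsTransport q e u d → IsTransport q (e ∘ s) (u ∘ s) (d ∘ s)
    transport-∘ {e = e} {u} {d} s (endpoint , fixes-r) =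
      extendʳ s endpoint , λ f g usf≡rg →
        begin
          (d ∘ s) ∘ f ≡⟨ assoc d s f ⟩
          d ∘ (s ∘ f) ≡⟨ fixes-r (s ∘ f) g (trans (sym (assoc u s f)) usf≡rg) ⟩
          e ∘ (s ∘ f) ≡⟨ sym (assoc e s f) ⟩
          (e ∘ s) ∘ f ∎

    -- Along a path family h in 𝒜, transports exist: they are the diagonal
    -- fillers given by the lifting property of the base change of r along h.
    transport-𝒜 : ∀ {E T} (q : Hom E Y) → 𝒜 q →
                  (t : Hom T E) (h : Hom T (Path p pA)) → 𝒜 h →
                  q ∘ t ≡ ∂⁰ p pA ∘ h → Σ (Hom T E) (IsTransport q t h)
    transport-𝒜 {E} {T} q qA t h hA qt≡∂⁰h = d , endpoint , fixes-r
      where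
      module h*r = Pullback (pbˡ h (r p pA) hA)

      -- Over h*r, the endpoints of h agree (they come from reflexivity paths).
      square : q ∘ (t ∘ h*r.π₁) ≡ (∂¹ p pA ∘ h) ∘ h*r.π₁
      square = begin
        q ∘ (t ∘ h*r.π₁)          ≡⟨ extendʳ h*r.π₁ qt≡∂⁰h ⟩
        ∂⁰ p pA ∘ (h ∘ h*r.π₁)    ≡⟨ cong (∂⁰ p pA ∘_) h*r.commute ⟩
        ∂⁰ p pA ∘ (r p pA ∘ h*r.π₂) ≡⟨ extendʳ h*r.π₂ ∂⁰∘r≡∂¹∘r ⟩
        ∂¹ p pA ∘ (r p pA ∘ h*r.π₂) ≡⟨ cong (∂¹ p pA ∘_) (sym h*r.commute) ⟩
        ∂¹ p pA ∘ (h ∘ h*r.π₁)    ≡⟨ sym (assoc _ _ _) ⟩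
        (∂¹ p pA ∘ h) ∘ h*r.π₁    ∎

      filler : Σ (Hom T E) λ d → (d ∘ h*r.π₁ ≡ t ∘ h*r.π₁) × (q ∘ d ≡ ∂¹ p pA ∘ h)
      filler = r-llp p pA h hA (pbˡ h (r p pA) hA) q qA
                 (t ∘ h*r.π₁) (∂¹ p pA ∘ h) square

      d : Hom T E
      d = proj₁ filler

      endpoint : q ∘ d ≡ ∂¹ p pA ∘ h
      endpoint = proj₂ (proj₂ filler)

      fixes-r : ∀ {W} (f : Hom W T) (g : Hom W Y) → h ∘ f ≡ r p pA ∘ g → d ∘ f ≡ t ∘ f
      fixes-r f g hf≡rg =
        agree-through h*r.⟨ f , g ⟩[ hf≡rg ] (proj₁ (proj₂ filler))
                      (h*r.π₁∘⟨⟩ f g hf≡rg)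

lemma2p10 : ∀ {o ℓ a : Level} (𝕋 : TribeWithPaths o ℓ a) →
    let open TribeWithPaths 𝕋 in
    ∀ {X Y E Z} (p : Hom Y X) (pA : 𝒜 p)
      (q : Hom E Y) (e : Hom Z E) (u : Hom Z (Path p pA)) →
      q ∘ e ≡ ∂⁰ p pA ∘ u →
      𝒜 q →
      Σ (Hom Z E) λ u!e →
        (q ∘ u!e ≡ ∂¹ p pA ∘ u) ×
        (∀ {W} (f : Hom W Z) (g : Hom W Y) → u ∘ f ≡ r p pA ∘ g → u!e ∘ f ≡ e ∘ f)
lemma2p10 𝕋 {E = E} {Z} p pA q e u qe≡∂⁰u qA = d ∘ ⟨e,u⟩ , transport-along-u
  where
  open TribeWithPaths 𝕋
  open Transport 𝕋

  universal : Pullback cat q (∂⁰ p pA)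
  universal = pbˡ q (∂⁰ p pA) qA
  module U = Pullback universal

  universal-transport : Σ (Hom U.P E) (IsTransport p pA q U.π₁ U.π₂)
  universal-transport = transport-𝒜 p pA q qA U.π₁ U.π₂
                          (𝒜-basechange qA universal) U.commute

  d : Hom U.P E
  d = proj₁ universal-transport

  ⟨e,u⟩ : Hom Z U.P
  ⟨e,u⟩ = U.⟨ e , u ⟩[ qe≡∂⁰u ]

  transport-along-u : IsTransport p pA q e u (d ∘ ⟨e,u⟩)
  transport-along-u =
    subst₂ (λ e′ u′ → IsTransport p pA q e′ u′ (d ∘ ⟨e,u⟩))
           (U.π₁∘⟨⟩ e u qe≡∂⁰u) (U.π₂∘⟨⟩ e u qe≡∂⁰u)
           (transport-∘ p pA ⟨e,u⟩ (proj₂ universal-transport))
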